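{- Let $G$ be a planar graph, $L$ a $3$-list-assignment for $G$, and $v_1,\dots,v_k\in V(G)$ distinct vertices. For $i=0,\dots,k$ let $G_i=G-\{v_{i+1},\dots,v_k\}$ (so $G_k=G$). Consider the properties: (1) for every $i=1,\dots,k$, $\deg_{G_i}(v_i)\le 5$; (2) there exists $i\in\{1,\dots,k\}$ with $\deg_{G_i}(v_i)\le 3$. If (1) holds, then every arboreal $L$-coloring of $G_0$ can be extended to an arboreal $L$-coloring of $G$. If both (1) and (2) hold, then every arboreal $L$-coloring of $G_0$ can be extended to an arboreal $L$-coloring of $G$ in at least two ways.
   Context: A $3$-list-assignment $L$ for $G$ assigns to each vertex $v$ a set $L(v)$ of exactly $3$ colors. An arboreal $L$-coloring of a graph $H$ (with lists $L$ restricted to $V(H)$) is a function $f$ with $f(v)\in L(v)$ for all $v\in V(H)$ such that each color class induces a forest in $H$. -}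

module Defs where

open import Data.Nat using (ℕ; zero; suc; _≤_; _<_; _≤ᵇ_)
open import Data.Bool using (Bool; true; false; not; _∧_)
open import Data.Fin using (Fin; toℕ)
open import Data.Fin.Properties using () renaming (_≟_ to _≟F_)
open import Data.List using (List; []; _∷_; length; allFin; filterᵇ; _∷ʳ_)
open import Data.Bool.ListAction using (any)
open import Data.List.Membership.Propositional using (_∈_)
open import Data.List.Relation.Unary.All using (All)
open import Data.List.Relation.Unary.Linked using (Linked)
open import Data.List.Relation.Unary.Unique.Propositional using (Unique)
open import Data.Maybe using (Maybe; just)
open import Data.Product using (Σ; ∃; ∃₂; _×_)
open import Data.Empty using (⊥)
open import Data.Unit using (⊤)
open import Relation.Nullary using (¬_)
open import Relation.Nullary.Decidable using (⌊_⌋)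
open import Relation.Binary.PropositionalEquality using (_≡_; _≢_)

record Graph (n : ℕ) : Set where
  field
    adj    : Fin n → Fin n → Bool
    sym    : ∀ u v → adj u v ≡ adj v u
    irrefl : ∀ v → adj v v ≡ false
open Graph public

Edge : ∀ {n} → Graph n → Fin n → Fin n → Set
Edge G u v = adj G u v ≡ true

data WalkIn {n} (G : Graph n) (S : Fin n → Set) : Fin n → Fin n → Set where
  here : ∀ {a} → S a → WalkIn G S a a
  step : ∀ {a b c} → S a → Edge G a b → WalkIn G S b c → WalkIn G S a c

ConnectedSet : ∀ {n} → Graph n → (Fin n → Set) → Set
ConnectedSet G S = ∀ a b → S a → S b → WalkIn G S a b

record MinorModel {n} (G : Graph n) (m : ℕ) (H : Fin m → Fin m → Set) : Set where
  field
    branch    : Fin n → Maybe (Fin m)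
    nonempty  : ∀ i → ∃ λ v → branch v ≡ just i
    connected : ∀ i → ConnectedSet G (λ v → branch v ≡ just i)
    adjacent  : ∀ i j → H i j →
                ∃₂ λ u v → branch u ≡ just i × branch v ≡ just j × Edge G u v

K5 : Fin 5 → Fin 5 → Set
K5 i j = i ≢ j

K33 : Fin 6 → Fin 6 → Set
K33 i j = (toℕ i < 3 × 3 ≤ toℕ j) Data.Sum.⊎ (toℕ j < 3 × 3 ≤ toℕ i)
  where import Data.Sum

-- Planarity via Wagner's theorem: no K5 minor and no K3,3 minor.
Planar : ∀ {n} → Graph n → Set
Planar G = ¬ MinorModel G 5 K5 × ¬ MinorModel G 6 K33

Is3ListAssignment : ∀ {n} → (Fin n → List ℕ) → Set
Is3ListAssignment L = ∀ v → length (L v) ≡ 3 × Unique (L v)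

IsCycle : ∀ {n} → Graph n → Fin n → List (Fin n) → Set
IsCycle G x xs = 2 ≤ length xs × Unique (x ∷ xs) × Linked (Edge G) ((x ∷ xs) ∷ʳ x)

-- Arboreal L-colouring of the induced subgraph G[S]: f(v) ∈ L(v) for v ∈ S,
-- and no cycle of G[S] is monochromatic (each colour class induces a forest).
ArborealColoring : ∀ {n} → Graph n → (Fin n → List ℕ) → (Fin n → Set) → (Fin n → ℕ) → Set
ArborealColoring G L S f =
  (∀ v → S v → f v ∈ L v) ×
  (∀ x xs → IsCycle G x xs → All S (x ∷ xs) → All (λ u → f u ≡ f x) xs → ⊥)

-- vs j represents v_{j+1}.  inGᵇ vs i u: u ∈ V(G_i), G_i = G - {v_{i+1},...,v_k},
-- i.e. u ≠ vs j for every j with i ≤ toℕ j.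
inGᵇ : ∀ {n k} → (Fin k → Fin n) → ℕ → Fin n → Bool
inGᵇ {k = k} vs i u = not (any (λ j → (i ≤ᵇ toℕ j) ∧ ⌊ u ≟F vs j ⌋) (allFin k))

VG : ∀ {n k} → (Fin k → Fin n) → ℕ → Fin n → Set
VG vs i u = inGᵇ vs i u ≡ true

degIn : ∀ {n k} → Graph n → (Fin k → Fin n) → ℕ → Fin n → ℕ
degIn {n} G vs i v = length (filterᵇ (λ u → adj G v u ∧ inGᵇ vs i u) (allFin n))

Extension : ∀ {n k} → Graph n → (Fin n → List ℕ) → (Fin k → Fin n) →
            (Fin n → ℕ) → (Fin n → ℕ) → Set
Extension G L vs f0 f =
  (∀ u → VG vs 0 u → f u ≡ f0 u) × ArborealColoring G L (λ _ → ⊤) f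

-- The vertices v₁, …, v_k are added back one at a time.  When v_j joins G_{j-1} it has at
-- most five neighbors in G_j, so by pigeonhole one of its three colors occurs at most once
-- among them (two such colors if it has at most three neighbors).  Giving v_j such a color
-- creates no monochromatic cycle, since a cycle through v_j meets two distinct neighbors of
-- v_j.

module Submission where

open import Defs hiding (sym)
open import Data.Bool using (Bool; true; false; not; _∧_; _∨_; T)
open import Data.Bool.Properties using (T-∧; T-∨; T-≡)
open import Data.Empty using (⊥; ⊥-elim)
open import Data.Fin using (Fin; toℕ; fromℕ<)
open import Data.Fin.Properties using (toℕ-injective; toℕ<n; toℕ-fromℕ<) renaming (_≟_ to _≟F_)
open import Data.List using (List; []; _∷_; _++_; [_]; _∷ʳ_; length; allFin; filterᵇ)
open import Data.List.Membership.Propositional using (_∈_; lose)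
open import Data.List.Membership.Propositional.Properties using (∈-allFin; ∈-∃++)
open import Data.List.Relation.Binary.Permutation.Propositional using (_↭_; ↭-refl; ↭-sym; ↭⇒↭ₛ)
open import Data.List.Relation.Binary.Permutation.Propositional.Properties
  using (++-comm; ∈-resp-↭; ↭-length)
open import Data.List.Relation.Binary.Permutation.Setoid.Properties using (Unique-resp-↭)
open import Data.List.Relation.Unary.All as All using (All; []; _∷_)
open import Data.List.Relation.Unary.AllPairs using ([]; _∷_)
open import Data.List.Relation.Unary.Any using (here; there; satisfied; any?)
open import Data.List.Relation.Unary.Any.Properties using (any⁺; any⁻)
open import Data.List.Relation.Unary.Linked as Linked using (Linked; [-]; _∷_)
open import Data.List.Relation.Unary.Unique.Propositional using (Unique)
open import Data.Nat
  using (ℕ; suc; pred; _+_; _≤_; _<_; _≤′_; _≤ᵇ_; _≡ᵇ_; z≤n; s≤s; ≤′-refl; ≤′-step)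
open import Data.Nat.Properties
  using ( module ≤-Reasoning; ≤-refl; ≤-trans; <⇒≤; <⇒≱; <-irrefl; n≮n; ≰⇒>; _≤?_; ≤⇒≤′; ≤′⇒≤
        ; m≤n⇒m≤1+n; m≤n⇒m<n∨m≡n; m≤m+n; m≤n+m; +-suc; +-mono-≤; +-monoˡ-≤
        ; ≤ᵇ⇒≤; ≤⇒≤ᵇ; ≡ᵇ⇒≡; ≡⇒≡ᵇ )
open import Data.Product using (∃; ∃₂; _×_; _,_; proj₁; proj₂)
open import Data.Sum using (_⊎_; inj₁; inj₂; [_,_]′)
open import Data.Unit using (⊤)
open import Function using (_∘_; case_of_)
open import Function.Bundles using (Equivalence)
open import Relation.Binary.PropositionalEquality
  using (_≡_; _≢_; refl; sym; trans; cong; subst; setoid; module ≡-Reasoning)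
open import Relation.Nullary using (¬_; yes; no; contradiction)
open import Relation.Nullary.Decidable using (⌊_⌋; toWitness; fromWitness)

module _ {A : Set} where

  countᵇ : (A → Bool) → List A → ℕ
  countᵇ p xs = length (filterᵇ p xs)

  countᵇ-≥1 : ∀ {p : A → Bool} {x xs} → x ∈ xs → T (p x) → 1 ≤ countᵇ p xs
  countᵇ-≥1 {p} {xs = y ∷ xs} (here refl) px with p y
  ... | true = s≤s z≤n
  countᵇ-≥1 {p} {xs = y ∷ xs} (there x∈) px with p y
  ... | true  = s≤s z≤n
  ... | false = countᵇ-≥1 x∈ px

  countᵇ-≥2 : ∀ {p : A → Bool} {a b xs} → a ≢ b → a ∈ xs → b ∈ xs → T (p a) → T (p b) →
              2 ≤ countᵇ p xs
  countᵇ-≥2 a≢b (here refl) (here refl) _ _ = ⊥-elim (a≢b refl)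
  countᵇ-≥2 {p} {xs = y ∷ xs} a≢b (here refl) (there b∈) pa pb with p y
  ... | true = s≤s (countᵇ-≥1 b∈ pb)
  countᵇ-≥2 {p} {xs = y ∷ xs} a≢b (there a∈) (here refl) pa pb with p y
  ... | true = s≤s (countᵇ-≥1 a∈ pa)
  countᵇ-≥2 {p} {xs = y ∷ xs} a≢b (there a∈) (there b∈) pa pb with p y
  ... | true  = m≤n⇒m≤1+n (countᵇ-≥2 a≢b a∈ b∈ pa pb)
  ... | false = countᵇ-≥2 a≢b a∈ b∈ pa pb

  countᵇ-mono : ∀ {p q : A → Bool} → (∀ x → T (p x) → T (q x)) → ∀ xs → countᵇ p xs ≤ countᵇ q xs
  countᵇ-mono p⇒q [] = z≤n
  countᵇ-mono {p} {q} p⇒q (x ∷ xs) with p x | q x | p⇒q x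
  ... | true  | true  | _ = s≤s (countᵇ-mono p⇒q xs)
  ... | true  | false | p⇒qx = ⊥-elim (p⇒qx _)
  ... | false | true  | _ = m≤n⇒m≤1+n (countᵇ-mono p⇒q xs)
  ... | false | false | _ = countᵇ-mono p⇒q xs

  countᵇ-∨ : ∀ {p q : A → Bool} → (∀ x → T (p x) → ¬ T (q x)) → ∀ xs →
             countᵇ p xs + countᵇ q xs ≡ countᵇ (λ x → p x ∨ q x) xs
  countᵇ-∨ disjoint [] = refl
  countᵇ-∨ {p} {q} disjoint (x ∷ xs) with p x | q x | disjoint x
  ... | true  | true  | d = ⊥-elim (d _ _)
  ... | true  | false | _ = cong suc (countᵇ-∨ disjoint xs)
  ... | false | true  | _ = trans (+-suc _ _) (cong suc (countᵇ-∨ disjoint xs))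
  ... | false | false | _ = countᵇ-∨ disjoint xs

  withColor : (A → Bool) → (A → ℕ) → ℕ → A → Bool
  withColor p g c x = p x ∧ (g x ≡ᵇ c)

  module _ {p : A → Bool} {g : A → ℕ} where

    withColor⇒ : ∀ {c x} → T (withColor p g c x) → T (p x)
    withColor⇒ = proj₁ ∘ Equivalence.to T-∧

    withColor⇒≡ : ∀ {c x} → T (withColor p g c x) → g x ≡ c
    withColor⇒≡ {c} {x} = ≡ᵇ⇒≡ (g x) c ∘ proj₂ ∘ Equivalence.to T-∧

    withColor-disjoint : ∀ {c₁ c₂} → c₁ ≢ c₂ → ∀ x →
                         T (withColor p g c₁ x) → ¬ T (withColor p g c₂ x)
    withColor-disjoint c₁≢c₂ x h₁ h₂ = c₁≢c₂ (trans (sym (withColor⇒≡ h₁)) (withColor⇒≡ h₂))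

    countᵇ-withColor₃ : ∀ {c₁ c₂ c₃} → c₁ ≢ c₂ → c₁ ≢ c₃ → c₂ ≢ c₃ → ∀ xs →
      countᵇ (withColor p g c₁) xs + countᵇ (withColor p g c₂) xs + countᵇ (withColor p g c₃) xs
        ≤ countᵇ p xs
    countᵇ-withColor₃ {c₁} {c₂} {c₃} c₁≢c₂ c₁≢c₃ c₂≢c₃ xs = begin
      countᵇ P₁ xs + countᵇ P₂ xs + countᵇ P₃ xs
        ≡⟨ cong (_+ countᵇ P₃ xs) (countᵇ-∨ (withColor-disjoint c₁≢c₂) xs) ⟩
      countᵇ P₁₂ xs + countᵇ P₃ xs
        ≡⟨ countᵇ-∨ P₁₂-disjoint-P₃ xs ⟩
      countᵇ (λ x → P₁₂ x ∨ P₃ x) xs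
        ≤⟨ countᵇ-mono P₁₂₃⇒p xs ⟩
      countᵇ p xs ∎
      where
      open ≤-Reasoning

      P₁ P₂ P₃ P₁₂ : A → Bool
      P₁ = withColor p g c₁
      P₂ = withColor p g c₂
      P₃ = withColor p g c₃
      P₁₂ x = P₁ x ∨ P₂ x

      P₁₂-disjoint-P₃ : ∀ x → T (P₁₂ x) → ¬ T (P₃ x)
      P₁₂-disjoint-P₃ x =
        [ withColor-disjoint c₁≢c₃ x , withColor-disjoint c₂≢c₃ x ]′ ∘ Equivalence.to T-∨

      P₁₂₃⇒p : ∀ x → T (P₁₂ x ∨ P₃ x) → T (p x)
      P₁₂₃⇒p x =
        [ [ withColor⇒ , withColor⇒ ]′ ∘ Equivalence.to T-∨ , withColor⇒ ]′ ∘ Equivalence.to T-∨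

one-of-three-≤1 : ∀ a b c → a + b + c ≤ 5 → a ≤ 1 ⊎ b ≤ 1 ⊎ c ≤ 1
one-of-three-≤1 a b c sum≤5 with a ≤? 1 | b ≤? 1 | c ≤? 1
... | yes a≤1 | _       | _       = inj₁ a≤1
... | no _    | yes b≤1 | _       = inj₂ (inj₁ b≤1)
... | no _    | no _    | yes c≤1 = inj₂ (inj₂ c≤1)
... | no a≰1  | no b≰1  | no c≰1  =
  contradiction (≤-trans (+-mono-≤ (+-mono-≤ (≰⇒> a≰1) (≰⇒> b≰1)) (≰⇒> c≰1)) sum≤5) (n≮n 5)

pair-≰1⇒sum≰3 : ∀ {x y} → ¬ x ≤ 1 → ¬ y ≤ 1 → ¬ x + y ≤ 3
pair-≰1⇒sum≰3 x≰1 y≰1 x+y≤3 = n≮n 3 (≤-trans (+-mono-≤ (≰⇒> x≰1) (≰⇒> y≰1)) x+y≤3)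

two-of-three-≤1 : ∀ a b c → a + b + c ≤ 3 → (a ≤ 1 × b ≤ 1) ⊎ (a ≤ 1 × c ≤ 1) ⊎ (b ≤ 1 × c ≤ 1)
two-of-three-≤1 a b c sum≤3 with a ≤? 1 | b ≤? 1 | c ≤? 1
... | yes a≤1 | yes b≤1 | _       = inj₁ (a≤1 , b≤1)
... | yes a≤1 | no _    | yes c≤1 = inj₂ (inj₁ (a≤1 , c≤1))
... | no _    | yes b≤1 | yes c≤1 = inj₂ (inj₂ (b≤1 , c≤1))
... | yes _   | no b≰1  | no c≰1  =
  ⊥-elim (pair-≰1⇒sum≰3 b≰1 c≰1 (≤-trans (+-monoˡ-≤ c (m≤n+m b a)) sum≤3))
... | no a≰1  | _       | no c≰1  =
  ⊥-elim (pair-≰1⇒sum≰3 a≰1 c≰1 (≤-trans (+-monoˡ-≤ c (m≤m+n a b)) sum≤3))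
... | no a≰1  | no b≰1  | yes _   =
  ⊥-elim (pair-≰1⇒sum≰3 a≰1 b≰1 (≤-trans (m≤m+n (a + b) c) sum≤3))

module _ {A : Set} (p : A → Bool) (g : A → ℕ) (xs : List A) where

  rareColor : ∀ {cs} → length cs ≡ 3 × Unique cs → countᵇ p xs ≤ 5 →
               ∃ λ c → c ∈ cs × countᵇ (withColor p g c) xs ≤ 1
  rareColor {c₁ ∷ c₂ ∷ c₃ ∷ []} (_ , (c₁≢c₂ ∷ c₁≢c₃ ∷ []) ∷ (c₂≢c₃ ∷ []) ∷ _) deg≤5
    with one-of-three-≤1 _ _ _ (≤-trans (countᵇ-withColor₃ {p = p} {g} c₁≢c₂ c₁≢c₃ c₂≢c₃ xs) deg≤5)
  ... | inj₁ c₁-rare        = c₁ , here refl , c₁-rare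
  ... | inj₂ (inj₁ c₂-rare) = c₂ , there (here refl) , c₂-rare
  ... | inj₂ (inj₂ c₃-rare) = c₃ , there (there (here refl)) , c₃-rare

  twoRareColors : ∀ {cs} → length cs ≡ 3 × Unique cs → countᵇ p xs ≤ 3 →
                  ∃₂ λ c c′ → c ≢ c′ × c ∈ cs × c′ ∈ cs ×
                              countᵇ (withColor p g c) xs ≤ 1 × countᵇ (withColor p g c′) xs ≤ 1
  twoRareColors {c₁ ∷ c₂ ∷ c₃ ∷ []} (_ , (c₁≢c₂ ∷ c₁≢c₃ ∷ []) ∷ (c₂≢c₃ ∷ []) ∷ _) deg≤3
    with two-of-three-≤1 _ _ _ (≤-trans (countᵇ-withColor₃ {p = p} {g} c₁≢c₂ c₁≢c₃ c₂≢c₃ xs) deg≤3)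
  ... | inj₁ (r₁ , r₂)        = c₁ , c₂ , c₁≢c₂ , here refl , there (here refl) , r₁ , r₂
  ... | inj₂ (inj₁ (r₁ , r₃)) = c₁ , c₃ , c₁≢c₃ , here refl , there (there (here refl)) , r₁ , r₃
  ... | inj₂ (inj₂ (r₂ , r₃)) = c₂ , c₃ , c₂≢c₃ , there (here refl) , there (there (here refl)) , r₂ , r₃

module _ {A : Set} {R : A → A → Set} where

  Linked-split : ∀ a p v q b → Linked R (a ∷ (p ++ v ∷ q) ++ [ b ]) →
                 Linked R (a ∷ p ++ [ v ]) × Linked R (v ∷ q ++ [ b ])
  Linked-split a []      v q b (r ∷ rs) = r ∷ [-] , rs
  Linked-split a (x ∷ p) v q b (r ∷ rs)
    with rs₁ , rs₂ ← Linked-split x p v q b rs = r ∷ rs₁ , rs₂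

  Linked-join : ∀ a p v q b → Linked R (a ∷ p ++ [ v ]) → Linked R (v ∷ q ++ [ b ]) →
                Linked R (a ∷ (p ++ v ∷ q) ++ [ b ])
  Linked-join a []      v q b (r ∷ [-]) rs₂ = r ∷ rs₂
  Linked-join a (x ∷ p) v q b (r ∷ rs₁) rs₂ = r ∷ Linked-join x p v q b rs₁ rs₂

  Linked-predecessor : ∀ c zs d → Linked R (c ∷ zs ++ [ d ]) → ∃ λ b → b ∈ c ∷ zs × R b d
  Linked-predecessor c []       d (r ∷ _)  = c , here refl , r
  Linked-predecessor c (z ∷ zs) d (_ ∷ rs)
    with b , b∈ , r ← Linked-predecessor z zs d rs = b , there b∈ , r

  closedWalk-rotate : ∀ x xs {v} → Linked R ((x ∷ xs) ∷ʳ x) → v ∈ x ∷ xs →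
                      ∃ λ ys → (x ∷ xs) ↭ (v ∷ ys) × Linked R ((v ∷ ys) ∷ʳ v)
  closedWalk-rotate x xs rs (here refl) = xs , ↭-refl , rs
  closedWalk-rotate x xs {v} rs (there v∈) with p , q , refl ← ∈-∃++ v∈
    with rs₁ , rs₂ ← Linked-split x p v q x rs =
    q ++ x ∷ p , ++-comm (x ∷ p) (v ∷ q) , Linked-join v q x p v rs₂ rs₁

  closedWalk-startNeighbors : ∀ v ys → Unique (v ∷ ys) → 2 ≤ length ys → Linked R ((v ∷ ys) ∷ʳ v) →
                              ∃₂ λ a b → a ≢ b × R v a × R b v × a ∈ ys × b ∈ ys
  closedWalk-startNeighbors v (a ∷ y ∷ ys) (_ ∷ a∉ ∷ _) _ (Rva ∷ rs)
    with b , b∈ , Rbv ← Linked-predecessor y ys v (Linked.tail rs) =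
    a , b , All.lookup a∉ b∈ , Rva , Rbv , here refl , there b∈
  closedWalk-startNeighbors v (_ ∷ []) _ (s≤s ()) _

  closedWalk-neighbors : ∀ x xs {v} → Unique (x ∷ xs) → 2 ≤ length xs → Linked R ((x ∷ xs) ∷ʳ x) →
                         v ∈ x ∷ xs → ∃₂ λ a b → a ≢ b × R v a × R b v × a ∈ x ∷ xs × b ∈ x ∷ xs
  closedWalk-neighbors x xs {v} unique len rs v∈
    with ys , xs↭ys , rs′ ← closedWalk-rotate x xs rs v∈
    with a , b , a≢b , Rva , Rbv , a∈ , b∈ ←
           closedWalk-startNeighbors v ys (Unique-resp-↭ (setoid A) (↭⇒↭ₛ xs↭ys) unique)
             (subst (2 ≤_) (cong pred (↭-length xs↭ys)) len) rs′ =
    a , b , a≢b , Rva , Rbv , ∈-resp-↭ (↭-sym xs↭ys) (there a∈) , ∈-resp-↭ (↭-sym xs↭ys) (there b∈)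

cycle-neighbors : ∀ {n} (G : Graph n) {x xs v} → IsCycle G x xs → v ∈ x ∷ xs →
                  ∃₂ λ a b → a ≢ b × Edge G v a × Edge G v b × a ∈ x ∷ xs × b ∈ x ∷ xs
cycle-neighbors G {x} {xs} (len , unique , rs) v∈
  with a , b , a≢b , va , bv , a∈ , b∈ ← closedWalk-neighbors x xs unique len rs v∈ =
  a , b , a≢b , va , trans (Graph.sym G _ b) bv , a∈ , b∈

module _ {n : ℕ} where

  recolor : (Fin n → ℕ) → Fin n → ℕ → Fin n → ℕ
  recolor g v c u with u ≟F v
  ... | yes _ = c
  ... | no  _ = g u

  recolor-at : ∀ g v c → recolor g v c v ≡ c
  recolor-at g v c with v ≟F v
  ... | yes _   = refl
  ... | no  v≢v = ⊥-elim (v≢v refl)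

  recolor-elsewhere : ∀ g v c {u} → u ≢ v → recolor g v c u ≡ g u
  recolor-elsewhere g v c {u} u≢v with u ≟F v
  ... | yes u≡v = ⊥-elim (u≢v u≡v)
  ... | no  _   = refl

module _ {n} (G : Graph n) where

  Edge⇒≢ : ∀ {u v} → Edge G u v → v ≢ u
  Edge⇒≢ {u} uv refl with () ← trans (sym (irrefl G u)) uv

  AtMostOneNeighborColored : (Fin n → Set) → (Fin n → ℕ) → Fin n → ℕ → Set
  AtMostOneNeighborColored S g v c =
    ∀ {a b} → S a → S b → Edge G v a → Edge G v b → g a ≡ c → g b ≡ c → a ≡ b

  arboreal-recolor : ∀ (L : Fin n → List ℕ) {S S′ : Fin n → Set} {g v c} →
                     (∀ {u} → S′ u → u ≢ v → S u) →
                     ArborealColoring G L S g → c ∈ L v → AtMostOneNeighborColored S′ g v c →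
                     ArborealColoring G L S′ (recolor g v c)
  arboreal-recolor L {S} {S′} {g} {v} {c} S′-v⊆S (inL , acyclic) c∈Lv sparse = inL′ , acyclic′
    where
    open ≡-Reasoning

    f : Fin n → ℕ
    f = recolor g v c

    inL′ : ∀ u → S′ u → f u ∈ L u
    inL′ u u∈ with u ≟F v
    ... | yes refl = c∈Lv
    ... | no  u≢v  = inL u (S′-v⊆S u∈ u≢v)

    acyclic′ : ∀ x xs → IsCycle G x xs → All S′ (x ∷ xs) → All (λ u → f u ≡ f x) xs → ⊥
    acyclic′ x xs cycle inS′ mono with any? (v ≟F_) (x ∷ xs)
    ... | no v∉ = acyclic x xs cycle (All.tabulate λ y∈ → S′-v⊆S (All.lookup inS′ y∈) (≢v y∈))
                    (All.tabulate λ {y} y∈ → begin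
                      g y ≡⟨ recolor-elsewhere g v c (≢v (there y∈)) ⟨
                      f y ≡⟨ All.lookup mono y∈ ⟩
                      f x ≡⟨ recolor-elsewhere g v c (≢v (here refl)) ⟩
                      g x ∎)
      where
      ≢v : ∀ {y} → y ∈ x ∷ xs → y ≢ v
      ≢v y∈ refl = v∉ y∈
    ... | yes v∈ with a , b , a≢b , va , vb , a∈ , b∈ ← cycle-neighbors G cycle v∈ =
      a≢b (sparse (All.lookup inS′ a∈) (All.lookup inS′ b∈) va vb
                  (colored-c va a∈) (colored-c vb b∈))
      where
      f≡f-x : ∀ {y} → y ∈ x ∷ xs → f y ≡ f x
      f≡f-x (here refl) = refl
      f≡f-x (there y∈)  = All.lookup mono y∈

      colored-c : ∀ {y} → Edge G v y → y ∈ x ∷ xs → g y ≡ c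
      colored-c {y} vy y∈ = begin
        g y ≡⟨ recolor-elsewhere g v c (Edge⇒≢ vy) ⟨
        f y ≡⟨ f≡f-x y∈ ⟩
        f x ≡⟨ f≡f-x v∈ ⟨
        f v ≡⟨ recolor-at g v c ⟩
        c   ∎

private
  not≡true⇒¬T : ∀ {b} → not b ≡ true → ¬ T b
  not≡true⇒¬T {true} ()

  ¬T⇒not≡true : ∀ {b} → ¬ T b → not b ≡ true
  ¬T⇒not≡true {true}  ¬b = ⊥-elim (¬b _)
  ¬T⇒not≡true {false} _ = refl

module _ {n k : ℕ} (vs : Fin k → Fin n) where

  private
    removedBefore : ℕ → Fin n → Fin k → Bool
    removedBefore i u m = (i ≤ᵇ toℕ m) ∧ ⌊ u ≟F vs m ⌋

  VG⁻ : ∀ {i u} → VG vs i u → ∀ m → i ≤ toℕ m → u ≢ vs m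
  VG⁻ {i} {u} u∈ m i≤m refl =
    not≡true⇒¬T u∈ (any⁺ (removedBefore i u)
      (lose (∈-allFin m) (Equivalence.from T-∧ (≤⇒≤ᵇ i≤m , fromWitness refl))))

  VG⁺ : ∀ {i u} → (∀ m → i ≤ toℕ m → u ≢ vs m) → VG vs i u
  VG⁺ {i} {u} avoids = ¬T⇒not≡true λ hit →
    let m , removed = satisfied (any⁻ (removedBefore i u) (allFin k) hit)
        i≤ᵇm , u≟vs = Equivalence.to T-∧ removed
    in avoids m (≤ᵇ⇒≤ i (toℕ m) i≤ᵇm) (toWitness u≟vs)

  VG-mono : ∀ {i i′ u} → i ≤ i′ → VG vs i u → VG vs i′ u
  VG-mono i≤i′ u∈ = VG⁺ λ m i′≤m → VG⁻ u∈ m (≤-trans i≤i′ i′≤m)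

  VG-total : ∀ {i u} → k ≤ i → VG vs i u
  VG-total k≤i = VG⁺ λ m i≤m _ → <⇒≱ (toℕ<n m) (≤-trans k≤i i≤m)

  vs∉VG : ∀ {i} j → i ≤ toℕ j → ¬ VG vs i (vs j)
  vs∉VG j i≤j vs∈ = VG⁻ vs∈ j i≤j refl

  VG-suc⁻ : ∀ j {u} → VG vs (suc (toℕ j)) u → u ≢ vs j → VG vs (toℕ j) u
  VG-suc⁻ j u∈ u≢vsj = VG⁺ λ m j≤m → case m≤n⇒m<n∨m≡n j≤m of λ where
    (inj₁ j<m) → VG⁻ u∈ m j<m
    (inj₂ j≡m) → subst (λ m → _ ≢ vs m) (toℕ-injective j≡m) u≢vsj

  vs∈VG-suc : (∀ a b → vs a ≡ vs b → a ≡ b) → ∀ j → VG vs (suc (toℕ j)) (vs j)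
  vs∈VG-suc injective j = VG⁺ λ m j<m vsj≡vsm →
    <-irrefl (cong toℕ (injective j m vsj≡vsm)) j<m

module Extending {n k} (G : Graph n) (L : Fin n → List ℕ) (vs : Fin k → Fin n)
                 (L-3 : Is3ListAssignment L)
                 (deg≤5 : ∀ (j : Fin k) → degIn G vs (suc (toℕ j)) (vs j) ≤ 5) where

  ArborealOn : ℕ → (Fin n → ℕ) → Set
  ArborealOn i = ArborealColoring G L (VG vs i)

  -- A record rather than a bare Π-type, so that the stage i is inferable from Agree i f g.
  record Agree (i : ℕ) (f g : Fin n → ℕ) : Set where
    constructor agree
    field on : ∀ u → VG vs i u → f u ≡ g u
  open Agree

  Agree-trans : ∀ {i f g h} → Agree i f g → Agree i g h → Agree i f h
  Agree-trans f≈g g≈h = agree λ u u∈ → trans (on f≈g u u∈) (on g≈h u u∈)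

  Agree-weaken : ∀ {i i′ f g} → i ≤ i′ → Agree i′ f g → Agree i f g
  Agree-weaken i≤i′ f≈g = agree λ u u∈ → on f≈g u (VG-mono vs i≤i′ u∈)

  Arboreal-total : ∀ {f} → ArborealOn k f → ArborealColoring G L (λ _ → ⊤) f
  Arboreal-total (inL , acyclic) =
    (λ u _ → inL u (VG-total vs ≤-refl)) ,
    (λ x xs cycle _ → acyclic x xs cycle (All.tabulate λ _ → VG-total vs ≤-refl))

  laterNeighbor : Fin k → Fin n → Bool
  laterNeighbor j u = adj G (vs j) u ∧ inGᵇ vs (suc (toℕ j)) u

  rare⇒AtMostOne : ∀ j {g c} → countᵇ (withColor (laterNeighbor j) g c) (allFin n) ≤ 1 →
                   AtMostOneNeighborColored G (VG vs (suc (toℕ j))) g (vs j) c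
  rare⇒AtMostOne j {g} {c} rare {a} {b} a∈ b∈ ja jb ga gb with a ≟F b
  ... | yes a≡b = a≡b
  ... | no  a≢b = ⊥-elim (n≮n 1 (≤-trans two≤count rare))
    where
    hit : ∀ {u} → Edge G (vs j) u → VG vs (suc (toℕ j)) u → g u ≡ c →
          T (withColor (laterNeighbor j) g c u)
    hit {u} ju u∈ gu = Equivalence.from T-∧
      (Equivalence.from T-∧ (Equivalence.from T-≡ ju , Equivalence.from T-≡ u∈) , ≡⇒≡ᵇ (g u) c gu)

    two≤count : 2 ≤ countᵇ (withColor (laterNeighbor j) g c) (allFin n)
    two≤count = countᵇ-≥2 a≢b (∈-allFin a) (∈-allFin b) (hit ja a∈ ga) (hit jb b∈ gb)

  recolor-step : ∀ j {g c} → c ∈ L (vs j) →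
                 countᵇ (withColor (laterNeighbor j) g c) (allFin n) ≤ 1 → ArborealOn (toℕ j) g →
                 ArborealOn (suc (toℕ j)) (recolor g (vs j) c) × Agree (toℕ j) (recolor g (vs j) c) g
  recolor-step j {g} {c} c∈L rare g∈ =
    arboreal-recolor G L (VG-suc⁻ vs j) g∈ c∈L (rare⇒AtMostOne j rare) ,
    agree λ u u∈ → recolor-elsewhere g (vs j) c λ where refl → vs∉VG vs j ≤-refl u∈

  extend-step : ∀ {i g} → i < k → ArborealOn i g → ∃ λ g′ → ArborealOn (suc i) g′ × Agree i g′ g
  extend-step {g = g} i<k g∈ with fromℕ< i<k | toℕ-fromℕ< i<k
  ... | j | refl
    with c , c∈L , rare ← rareColor (laterNeighbor j) g (allFin n) (L-3 (vs j)) (deg≤5 j) =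
    recolor g (vs j) c , recolor-step j c∈L rare g∈

  extend : ∀ {i i′ g} → i ≤ i′ → i′ ≤ k → ArborealOn i g → ∃ λ f → ArborealOn i′ f × Agree i f g
  extend i≤i′ = go (≤⇒≤′ i≤i′)
    where
    go : ∀ {i i′ g} → i ≤′ i′ → i′ ≤ k → ArborealOn i g → ∃ λ f → ArborealOn i′ f × Agree i f g
    go ≤′-refl        _      g∈ = _ , g∈ , agree λ _ _ → refl
    go (≤′-step i≤′i′) i′<k g∈
      with f , f∈ , f≈g ← go i≤′i′ (<⇒≤ i′<k) g∈
      with f′ , f′∈ , f′≈f ← extend-step i′<k f∈ =
      f′ , f′∈ , Agree-trans (Agree-weaken (≤′⇒≤ i≤′i′) f′≈f) f≈g

  extend-step₂ : ∀ j {g} → degIn G vs (suc (toℕ j)) (vs j) ≤ 3 → ArborealOn (toℕ j) g →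
                 ∃₂ λ g₁ g₂ → (ArborealOn (suc (toℕ j)) g₁ × Agree (toℕ j) g₁ g) ×
                              (ArborealOn (suc (toℕ j)) g₂ × Agree (toℕ j) g₂ g) ×
                              g₁ (vs j) ≢ g₂ (vs j)
  extend-step₂ j {g} deg≤3 g∈
    with c , c′ , c≢c′ , c∈L , c′∈L , rare , rare′ ←
           twoRareColors (laterNeighbor j) g (allFin n) (L-3 (vs j)) deg≤3 =
    recolor g (vs j) c , recolor g (vs j) c′ ,
    recolor-step j c∈L rare g∈ , recolor-step j c′∈L rare′ g∈ ,
    λ eq → c≢c′ (begin
      c                          ≡⟨ recolor-at g (vs j) c ⟨
      recolor g (vs j) c (vs j)  ≡⟨ eq ⟩
      recolor g (vs j) c′ (vs j) ≡⟨ recolor-at g (vs j) c′ ⟩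
      c′                         ∎)
    where open ≡-Reasoning

  extends : ∀ f₀ → ArborealOn 0 f₀ → ∃ λ f → Extension G L vs f₀ f
  extends f₀ f₀∈ with f , f∈ , f≈f₀ ← extend z≤n ≤-refl f₀∈ = f , on f≈f₀ , Arboreal-total f∈

  extends-twice : (∀ a b → vs a ≡ vs b → a ≡ b) →
                  (∃ λ (j : Fin k) → degIn G vs (suc (toℕ j)) (vs j) ≤ 3) →
                  ∀ f₀ → ArborealOn 0 f₀ →
                  ∃₂ λ f₁ f₂ → Extension G L vs f₀ f₁ × Extension G L vs f₀ f₂ × ∃ λ u → f₁ u ≢ f₂ u
  extends-twice injective (j , deg≤3) f₀ f₀∈
    with g , g∈ , g≈f₀ ← extend z≤n (<⇒≤ (toℕ<n j)) f₀∈
    with g₁ , g₂ , (g₁∈ , g₁≈g) , (g₂∈ , g₂≈g) , g₁≢g₂ ← extend-step₂ j deg≤3 g∈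
    with f₁ , f₁∈ , f₁≈g₁ ← extend (toℕ<n j) ≤-refl g₁∈
    with f₂ , f₂∈ , f₂≈g₂ ← extend (toℕ<n j) ≤-refl g₂∈ =
    f₁ , f₂ ,
    (on (via f₁≈g₁ g₁≈g) , Arboreal-total f₁∈) , (on (via f₂≈g₂ g₂≈g) , Arboreal-total f₂∈) ,
    vs j , λ f₁≡f₂ → g₁≢g₂ (trans (sym (on f₁≈g₁ (vs j) vsj∈))
                                  (trans f₁≡f₂ (on f₂≈g₂ (vs j) vsj∈)))
    where
    vsj∈ : VG vs (suc (toℕ j)) (vs j)
    vsj∈ = vs∈VG-suc vs injective j

    via : ∀ {f h} → Agree (suc (toℕ j)) f h → Agree (toℕ j) h g → Agree 0 f f₀
    via f≈h h≈g = Agree-trans (Agree-weaken z≤n f≈h) (Agree-trans (Agree-weaken z≤n h≈g) g≈f₀)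

mainTheorem4 : ∀ {n k} (G : Graph n) (L : Fin n → List ℕ) (vs : Fin k → Fin n) →
    Planar G → Is3ListAssignment L → (∀ a b → vs a ≡ vs b → a ≡ b) →
    (∀ (j : Fin k) → degIn G vs (suc (toℕ j)) (vs j) ≤ 5) →
    (∀ f0 → ArborealColoring G L (VG vs 0) f0 → ∃ λ f → Extension G L vs f0 f) ×
    ((∃ λ (j : Fin k) → degIn G vs (suc (toℕ j)) (vs j) ≤ 3) →
     ∀ f0 → ArborealColoring G L (VG vs 0) f0 →
     ∃₂ λ f1 f2 → Extension G L vs f0 f1 × Extension G L vs f0 f2 × ∃ λ u → f1 u ≢ f2 u)
mainTheorem4 G L vs _ L-3 injective deg≤5 = extends , extends-twice injective
  where open Extending G L vs L-3 deg≤5
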